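{- For every $\lambda$-variable $x$, term $t$ and value $v$ we have $(\lambda x\,t)\,v\equiv t[x:=v]$.
   Context: Fix pairwise disjoint countably infinite sets of $\lambda$-variables ($x,y,\dots$), stack variables ($\alpha,\beta,\dots$), term variables ($a,b,\dots$), and countable sets of labels $l$ and constructors $C$. Values, terms, stacks, processes: $v,w::=x\mid\lambda x\,t\mid C[v]\mid\{l_i=v_i\}_{i\in I}$; $t,u::=a\mid v\mid t\,u\mid\mu\alpha\,t\mid p\mid v.l\mid\mathrm{case}_v[C_i[x_i]\to t_i]_{i\in I}\mid\delta_{v,w}$; $\pi::=\alpha\mid v.\pi\mid[t]\pi$; $p::=t\ast\pi$; $I$ finite; $\lambda x$, $\mu\alpha$ and the $x_i$ in case branches are binders, term variables are never bound. Substitutions map $\lambda$-variables to values, stack variables to stacks, term variables to terms (capture-avoiding). $\succ$ is the smallest relation on processes with: $t\,u\ast\pi\succ u\ast[t]\pi$; $v\ast[t]\pi\succ t\ast v.\pi$; $\lambda x\,t\ast v.\pi\succ t[x:=v]\ast\pi$; $\mu\alpha\,t\ast\pi\succ t[\alpha:=\pi]\ast\pi$; $p\ast\pi\succ p$; $\{l_i=v_i\}_{i\in I}.l_k\ast\pi\succ v_k\ast\pi$ ($k\in I$); $\mathrm{case}_{C_k[v]}[C_i[x_i]\to t_i]_{i\in I}\ast\pi\succ t_k[x_k:=v]\ast\pi$ ($k\in I$). A process is final if it is $v\ast\alpha$ with $v$ a value and $\alpha$ a stack variable; for a relation $R$, $p\Downarrow_R$ means $p\,R^*\,q$ with $q$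 final. For $i\in\mathbb N$, inductively: $\rightsquigarrow_i=\succ\cup\{(\delta_{v,w}\ast\pi,v\ast\pi)\mid\exists j<i,\ v\not\equiv_jw\}$; $t\equiv_iu$ iff for all $j\le i$, stacks $\pi$, substitutions $\sigma$: $t\sigma\ast\pi\Downarrow_{\rightsquigarrow_j}\Leftrightarrow u\sigma\ast\pi\Downarrow_{\rightsquigarrow_j}$; $\not\equiv_i$ is its negation. $\equiv=\bigcap_i\equiv_i$. -}

module Defs where

open import Data.Nat using (ℕ; zero; suc)
open import Data.Product using (_×_; _,_; Σ; ∃)
open import Data.Sum using (_⊎_)
open import Data.Empty using (⊥)
open import Data.List using (List; []; _∷_)
open import Data.List.Membership.Propositional using (_∈_)
open import Relation.Nullary using (¬_)
open import Relation.Binary.PropositionalEquality using (_≡_)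
open import Relation.Binary.Construct.Closure.ReflexiveTransitive using (Star)
open import Function.Bundles using (_⇔_)

-- Syntax.
-- λ-variables and stack variables are de Bruijn indices (ℕ); binders
-- (λx, μα, and the x_i of case branches) bind index 0 of their sort.
-- Term variables are never bound: they are names (ℕ).

Label : Set
Label = ℕ

Constr : Set
Constr = ℕ

mutual
  data Val : Set where
    var  : ℕ → Val
    lam  : Term → Val
    con  : Constr → Val → Val
    rec  : List (Label × Val) → Val

  data Term : Set where
    tvar  : ℕ → Term
    val   : Val → Term
    app   : Term → Term → Term
    mu    : Term → Term
    proc  : Proc → Term
    proj  : Val → Label → Term
    case  : Val → List (Constr × Term) → Term
    delta : Val → Val → Term

  data Stack : Set where
    svar  : ℕ → Stack
    push  : Val → Stack → Stack
    frame : Term → Stack → Stack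

  data Proc : Set where
    _∗_ : Term → Stack → Proc

infix 4 _∗_

ext : (ℕ → ℕ) → ℕ → ℕ
ext f zero    = zero
ext f (suc n) = suc (f n)

mutual
  renV : (ℕ → ℕ) → (ℕ → ℕ) → Val → Val
  renV f g (var x)  = var (f x)
  renV f g (lam t)  = lam (renT (ext f) g t)
  renV f g (con c v) = con c (renV f g v)
  renV f g (rec fs) = rec (renFs f g fs)

  renFs : (ℕ → ℕ) → (ℕ → ℕ) → List (Label × Val) → List (Label × Val)
  renFs f g [] = []
  renFs f g ((l , v) ∷ fs) = (l , renV f g v) ∷ renFs f g fs

  renT : (ℕ → ℕ) → (ℕ → ℕ) → Term → Term
  renT f g (tvar a)    = tvar a
  renT f g (val v)     = val (renV f g v)
  renT f g (app t u)   = app (renT f g t) (renT f g u)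
  renT f g (mu t)      = mu (renT f (ext g) t)
  renT f g (proc p)    = proc (renP f g p)
  renT f g (proj v l)  = proj (renV f g v) l
  renT f g (case v bs) = case (renV f g v) (renBs f g bs)
  renT f g (delta v w) = delta (renV f g v) (renV f g w)

  renBs : (ℕ → ℕ) → (ℕ → ℕ) → List (Constr × Term) → List (Constr × Term)
  renBs f g [] = []
  renBs f g ((c , t) ∷ bs) = (c , renT (ext f) g t) ∷ renBs f g bs

  renS : (ℕ → ℕ) → (ℕ → ℕ) → Stack → Stack
  renS f g (svar α)    = svar (g α)
  renS f g (push v π)  = push (renV f g v) (renS f g π)
  renS f g (frame t π) = frame (renT f g t) (renS f g π)

  renP : (ℕ → ℕ) → (ℕ → ℕ) → Proc → Proc
  renP f g (t ∗ π) = renT f g t ∗ renS f g π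

id : ℕ → ℕ
id n = n

record Subst : Set where
  constructor subst
  field
    onλ : ℕ → Val
    onS : ℕ → Stack
    onT : ℕ → Term
open Subst public

upλ : Subst → Subst
upλ σ = subst f (λ n → renS suc id (onS σ n)) (λ n → renT suc id (onT σ n))
  where
  f : ℕ → Val
  f zero    = var zero
  f (suc n) = renV suc id (onλ σ n)

upS : Subst → Subst
upS σ = subst (λ n → renV id suc (onλ σ n)) f (λ n → renT id suc (onT σ n))
  where
  f : ℕ → Stack
  f zero    = svar zero
  f (suc n) = renS id suc (onS σ n)

mutual
  subV : Subst → Val → Val
  subV σ (var x)   = onλ σ x
  subV σ (lam t)   = lam (subT (upλ σ) t)
  subV σ (con c v) = con c (subV σ v)
  subV σ (rec fs)  = rec (subFs σ fs)

  subFs : Subst → List (Label × Val) → List (Label × Val)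
  subFs σ [] = []
  subFs σ ((l , v) ∷ fs) = (l , subV σ v) ∷ subFs σ fs

  subT : Subst → Term → Term
  subT σ (tvar a)    = onT σ a
  subT σ (val v)     = val (subV σ v)
  subT σ (app t u)   = app (subT σ t) (subT σ u)
  subT σ (mu t)      = mu (subT (upS σ) t)
  subT σ (proc p)    = proc (subP σ p)
  subT σ (proj v l)  = proj (subV σ v) l
  subT σ (case v bs) = case (subV σ v) (subBs σ bs)
  subT σ (delta v w) = delta (subV σ v) (subV σ w)

  subBs : Subst → List (Constr × Term) → List (Constr × Term)
  subBs σ [] = []
  subBs σ ((c , t) ∷ bs) = (c , subT (upλ σ) t) ∷ subBs σ bs

  subS : Subst → Stack → Stack
  subS σ (svar α)    = onS σ α
  subS σ (push v π)  = push (subV σ v) (subS σ π)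
  subS σ (frame t π) = frame (subT σ t) (subS σ π)

  subP : Subst → Proc → Proc
  subP σ (t ∗ π) = subT σ t ∗ subS σ π

-- t[x:=v]  (x = the λ-variable bound by the enclosing binder, index 0)
_[0≔_] : Term → Val → Term
t [0≔ v ] = subT (subst f svar tvar) t
  where
  f : ℕ → Val
  f zero    = v
  f (suc n) = var n

-- t[α:=π]  (α = the stack variable bound by the enclosing μ, index 0)
_[0≔ˢ_] : Term → Stack → Term
t [0≔ˢ π ] = subT (subst var f tvar) t
  where
  f : ℕ → Stack
  f zero    = π
  f (suc n) = svar n

infix 3 _≻_
data _≻_ : Proc → Proc → Set where
  ≻-app   : ∀ t u π → (app t u ∗ π) ≻ (u ∗ frame t π)
  ≻-frame : ∀ v t π → (val v ∗ frame t π) ≻ (t ∗ push v π)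
  ≻-beta  : ∀ t v π → (val (lam t) ∗ push v π) ≻ (t [0≔ v ] ∗ π)
  ≻-mu    : ∀ t π → (mu t ∗ π) ≻ (t [0≔ˢ π ] ∗ π)
  ≻-proc  : ∀ p π → (proc p ∗ π) ≻ p
  ≻-proj  : ∀ fs l v π → (l , v) ∈ fs → (proj (rec fs) l ∗ π) ≻ (val v ∗ π)
  ≻-case  : ∀ c v t bs π → (c , t) ∈ bs → (case (con c v) bs ∗ π) ≻ (t [0≔ v ] ∗ π)

data Final : Proc → Set where
  final : ∀ v α → Final (val v ∗ svar α)

Conv : (Proc → Proc → Set) → Proc → Set
Conv R p = Σ Proc (λ q → Star R p q × Final q)

-- NeqBelow i v w  ≔  ∃ j < i. v ≢_j w   (bounded quantifier unfolded)
--   Equiv i t u     ≔  ∀ j ≤ i. EquivAt j t u  (bounded quantifier unfolded)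

mutual
  Step : ℕ → Proc → Proc → Set
  Step i p q = (p ≻ q) ⊎ DeltaStep i p q

  DeltaStep : ℕ → Proc → Proc → Set
  DeltaStep i p q =
    Σ Val λ v → Σ Val λ w → Σ Stack λ π →
      (p ≡ (delta v w ∗ π)) × (q ≡ (val v ∗ π)) × NeqBelow i v w

  NeqBelow : ℕ → Val → Val → Set
  NeqBelow zero    v w = ⊥
  NeqBelow (suc i) v w = NeqBelow i v w ⊎ ¬ Equiv i (val v) (val w)

  EquivAt : ℕ → Term → Term → Set
  EquivAt j t u = (π : Stack) (σ : Subst) →
    Conv (Step j) (subT σ t ∗ π) ⇔ Conv (Step j) (subT σ u ∗ π)

  Equiv : ℕ → Term → Term → Set
  Equiv zero    t u = EquivAt zero t u
  Equiv (suc i) t u = Equiv i t u × EquivAt (suc i) t u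

infix 4 _≡ᵒ_
_≡ᵒ_ : Term → Term → Set
t ≡ᵒ u = (i : ℕ) → Equiv i t u

module Submission where

-- The process (λx t) v ∗ π reaches t[x:=v] ∗ π in three ≻-steps
-- (app, frame, β), and at every stratum ↝_j these are the only steps
-- available, since none of the intermediate processes is final or a
-- δ-redex. So both sides converge together under every substitution σ and
-- stack, once we know (t[x:=v])σ = (t σ⇑)[x:=vσ], with σ⇑ = upλ σ.
-- That substitution lemma follows from fusion, sub τ ∘ sub σ = sub (σ ⨾ τ),
-- proved in three rounds: pushing a substitution under a binder must
-- commute with weakening, which is fusion with a renaming, so we first
-- fuse a renaming followed by anything, then anything followed by a
-- renaming, and only then two arbitrary substitutions.

open import Defs
open import Data.Nat using (ℕ; zero; suc)
open import Data.Product using (_,_; ∃₂)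
open import Data.Sum using (inj₁; inj₂)
open import Data.List using ([]; _∷_)
open import Data.Unit using (⊤; tt)
open import Data.Empty using (⊥-elim)
open import Relation.Nullary using (¬_)
open import Relation.Binary.PropositionalEquality
  using (_≡_; refl; sym; trans; cong; cong₂; module ≡-Reasoning)
  renaming (subst to transport)
open import Relation.Binary.Construct.Closure.ReflexiveTransitive using (Star; ε; _◅_)
open import Function.Bundles using (_⇔_; mk⇔)
open import Function.Properties.Equivalence using () renaming (trans to ⇔-trans)

data Sort : Set where
  value stack term : Sort

Syntax : Sort → Set
Syntax value = Val
Syntax stack = Stack
Syntax term  = Term

lookup : (k : Sort) → Subst → ℕ → Syntax k
lookup value = onλ
lookup stack = onS
lookup term  = onT

sub : (k : Sort) → Subst → Syntax k → Syntax k
sub value = subV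
sub stack = subS
sub term  = subT

ren : (k : Sort) → (ℕ → ℕ) → (ℕ → ℕ) → Syntax k → Syntax k
ren value = renV
ren stack = renS
ren term  = renT

infix 4 _≈_
_≈_ : Subst → Subst → Set
σ ≈ τ = ∀ k n → lookup k σ n ≡ lookup k τ n

≈-trans : ∀ {σ τ ρ} → σ ≈ τ → τ ≈ ρ → σ ≈ ρ
≈-trans p q k n = trans (p k n) (q k n)

upλ-cong : ∀ {σ τ} → σ ≈ τ → upλ σ ≈ upλ τ
upλ-cong e value zero    = refl
upλ-cong e value (suc n) = cong (renV suc id) (e value n)
upλ-cong e stack n       = cong (renS suc id) (e stack n)
upλ-cong e term  n       = cong (renT suc id) (e term n)

upS-cong : ∀ {σ τ} → σ ≈ τ → upS σ ≈ upS τ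
upS-cong e value n       = cong (renV id suc) (e value n)
upS-cong e stack zero    = refl
upS-cong e stack (suc n) = cong (renS id suc) (e stack n)
upS-cong e term  n       = cong (renT id suc) (e term n)

mutual
  subV-cong : ∀ {σ τ} → σ ≈ τ → ∀ v → subV σ v ≡ subV τ v
  subV-cong e (var x)   = e value x
  subV-cong e (lam t)   = cong lam (subT-cong (upλ-cong e) t)
  subV-cong e (con c v) = cong (con c) (subV-cong e v)
  subV-cong e (rec fs)  = cong rec (subFs-cong e fs)

  subFs-cong : ∀ {σ τ} → σ ≈ τ → ∀ fs → subFs σ fs ≡ subFs τ fs
  subFs-cong e []             = refl
  subFs-cong e ((l , v) ∷ fs) = cong₂ (λ w ws → (l , w) ∷ ws) (subV-cong e v) (subFs-cong e fs)

  subT-cong : ∀ {σ τ} → σ ≈ τ → ∀ t → subT σ t ≡ subT τ t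
  subT-cong e (tvar a)    = e term a
  subT-cong e (val v)     = cong val (subV-cong e v)
  subT-cong e (app t u)   = cong₂ app (subT-cong e t) (subT-cong e u)
  subT-cong e (mu t)      = cong mu (subT-cong (upS-cong e) t)
  subT-cong e (proc p)    = cong proc (subP-cong e p)
  subT-cong e (proj v l)  = cong (λ w → proj w l) (subV-cong e v)
  subT-cong e (case v bs) = cong₂ case (subV-cong e v) (subBs-cong e bs)
  subT-cong e (delta v w) = cong₂ delta (subV-cong e v) (subV-cong e w)

  subBs-cong : ∀ {σ τ} → σ ≈ τ → ∀ bs → subBs σ bs ≡ subBs τ bs
  subBs-cong e []             = refl
  subBs-cong e ((c , t) ∷ bs) = cong₂ (λ u us → (c , u) ∷ us) (subT-cong (upλ-cong e) t) (subBs-cong e bs)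

  subS-cong : ∀ {σ τ} → σ ≈ τ → ∀ π → subS σ π ≡ subS τ π
  subS-cong e (svar α)    = e stack α
  subS-cong e (push v π)  = cong₂ push (subV-cong e v) (subS-cong e π)
  subS-cong e (frame t π) = cong₂ frame (subT-cong e t) (subS-cong e π)

  subP-cong : ∀ {σ τ} → σ ≈ τ → ∀ p → subP σ p ≡ subP τ p
  subP-cong e (t ∗ π) = cong₂ _∗_ (subT-cong e t) (subS-cong e π)

sub-cong : ∀ {σ τ} → σ ≈ τ → ∀ k x → sub k σ x ≡ sub k τ x
sub-cong e value = subV-cong e
sub-cong e stack = subS-cong e
sub-cong e term  = subT-cong e

ren-subst : (ℕ → ℕ) → (ℕ → ℕ) → Subst
ren-subst f g = subst (λ n → var (f n)) (λ n → svar (g n)) tvar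

idˢ wkλ wkμ : Subst
idˢ = ren-subst id id
wkλ = ren-subst suc id
wkμ = ren-subst id suc

upλ-renaming : ∀ f g → upλ (ren-subst f g) ≈ ren-subst (ext f) g
upλ-renaming f g value zero    = refl
upλ-renaming f g value (suc n) = refl
upλ-renaming f g stack n       = refl
upλ-renaming f g term  n       = refl

upS-renaming : ∀ f g → upS (ren-subst f g) ≈ ren-subst f (ext g)
upS-renaming f g value n       = refl
upS-renaming f g stack zero    = refl
upS-renaming f g stack (suc n) = refl
upS-renaming f g term  n       = refl

mutual
  renV-as-sub : ∀ f g v → renV f g v ≡ subV (ren-subst f g) v
  renV-as-sub f g (var x)   = refl
  renV-as-sub f g (lam t)   = cong lam (trans (renT-as-sub (ext f) g t) (sym (subT-cong (upλ-renaming f g) t)))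
  renV-as-sub f g (con c v) = cong (con c) (renV-as-sub f g v)
  renV-as-sub f g (rec fs)  = cong rec (renFs-as-sub f g fs)

  renFs-as-sub : ∀ f g fs → renFs f g fs ≡ subFs (ren-subst f g) fs
  renFs-as-sub f g []             = refl
  renFs-as-sub f g ((l , v) ∷ fs) = cong₂ (λ w ws → (l , w) ∷ ws) (renV-as-sub f g v) (renFs-as-sub f g fs)

  renT-as-sub : ∀ f g t → renT f g t ≡ subT (ren-subst f g) t
  renT-as-sub f g (tvar a)    = refl
  renT-as-sub f g (val v)     = cong val (renV-as-sub f g v)
  renT-as-sub f g (app t u)   = cong₂ app (renT-as-sub f g t) (renT-as-sub f g u)
  renT-as-sub f g (mu t)      = cong mu (trans (renT-as-sub f (ext g) t) (sym (subT-cong (upS-renaming f g) t)))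
  renT-as-sub f g (proc p)    = cong proc (renP-as-sub f g p)
  renT-as-sub f g (proj v l)  = cong (λ w → proj w l) (renV-as-sub f g v)
  renT-as-sub f g (case v bs) = cong₂ case (renV-as-sub f g v) (renBs-as-sub f g bs)
  renT-as-sub f g (delta v w) = cong₂ delta (renV-as-sub f g v) (renV-as-sub f g w)

  renBs-as-sub : ∀ f g bs → renBs f g bs ≡ subBs (ren-subst f g) bs
  renBs-as-sub f g []             = refl
  renBs-as-sub f g ((c , t) ∷ bs) =
    cong₂ (λ u us → (c , u) ∷ us)
          (trans (renT-as-sub (ext f) g t) (sym (subT-cong (upλ-renaming f g) t)))
          (renBs-as-sub f g bs)

  renS-as-sub : ∀ f g π → renS f g π ≡ subS (ren-subst f g) π
  renS-as-sub f g (svar α)    = refl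
  renS-as-sub f g (push v π)  = cong₂ push (renV-as-sub f g v) (renS-as-sub f g π)
  renS-as-sub f g (frame t π) = cong₂ frame (renT-as-sub f g t) (renS-as-sub f g π)

  renP-as-sub : ∀ f g p → renP f g p ≡ subP (ren-subst f g) p
  renP-as-sub f g (t ∗ π) = cong₂ _∗_ (renT-as-sub f g t) (renS-as-sub f g π)

ren-as-sub : ∀ k f g x → ren k f g x ≡ sub k (ren-subst f g) x
ren-as-sub value = renV-as-sub
ren-as-sub stack = renS-as-sub
ren-as-sub term  = renT-as-sub

upλ-id : ∀ {σ} → σ ≈ idˢ → upλ σ ≈ idˢ
upλ-id e value zero    = refl
upλ-id e value (suc n) = cong (renV suc id) (e value n)
upλ-id e stack n       = cong (renS suc id) (e stack n)
upλ-id e term  n       = cong (renT suc id) (e term n)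

upS-id : ∀ {σ} → σ ≈ idˢ → upS σ ≈ idˢ
upS-id e value n       = cong (renV id suc) (e value n)
upS-id e stack zero    = refl
upS-id e stack (suc n) = cong (renS id suc) (e stack n)
upS-id e term  n       = cong (renT id suc) (e term n)

mutual
  subV-id : ∀ {σ} → σ ≈ idˢ → ∀ v → subV σ v ≡ v
  subV-id e (var x)   = e value x
  subV-id e (lam t)   = cong lam (subT-id (upλ-id e) t)
  subV-id e (con c v) = cong (con c) (subV-id e v)
  subV-id e (rec fs)  = cong rec (subFs-id e fs)

  subFs-id : ∀ {σ} → σ ≈ idˢ → ∀ fs → subFs σ fs ≡ fs
  subFs-id e []             = refl
  subFs-id e ((l , v) ∷ fs) = cong₂ (λ w ws → (l , w) ∷ ws) (subV-id e v) (subFs-id e fs)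

  subT-id : ∀ {σ} → σ ≈ idˢ → ∀ t → subT σ t ≡ t
  subT-id e (tvar a)    = e term a
  subT-id e (val v)     = cong val (subV-id e v)
  subT-id e (app t u)   = cong₂ app (subT-id e t) (subT-id e u)
  subT-id e (mu t)      = cong mu (subT-id (upS-id e) t)
  subT-id e (proc p)    = cong proc (subP-id e p)
  subT-id e (proj v l)  = cong (λ w → proj w l) (subV-id e v)
  subT-id e (case v bs) = cong₂ case (subV-id e v) (subBs-id e bs)
  subT-id e (delta v w) = cong₂ delta (subV-id e v) (subV-id e w)

  subBs-id : ∀ {σ} → σ ≈ idˢ → ∀ bs → subBs σ bs ≡ bs
  subBs-id e []             = refl
  subBs-id e ((c , t) ∷ bs) = cong₂ (λ u us → (c , u) ∷ us) (subT-id (upλ-id e) t) (subBs-id e bs)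

  subS-id : ∀ {σ} → σ ≈ idˢ → ∀ π → subS σ π ≡ π
  subS-id e (svar α)    = e stack α
  subS-id e (push v π)  = cong₂ push (subV-id e v) (subS-id e π)
  subS-id e (frame t π) = cong₂ frame (subT-id e t) (subS-id e π)

  subP-id : ∀ {σ} → σ ≈ idˢ → ∀ p → subP σ p ≡ p
  subP-id e (t ∗ π) = cong₂ _∗_ (subT-id e t) (subS-id e π)

sub-id : ∀ {σ} → σ ≈ idˢ → ∀ k x → sub k σ x ≡ x
sub-id e value = subV-id e
sub-id e stack = subS-id e
sub-id e term  = subT-id e

infixl 5 _⨾_
_⨾_ : Subst → Subst → Subst
σ ⨾ τ = subst (λ n → subV τ (onλ σ n)) (λ n → subS τ (onS σ n)) (λ n → subT τ (onT σ n))

⨾-upλ : ∀ {σ τ} →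
        (∀ k n → sub k (upλ τ) (ren k suc id (lookup k σ n)) ≡ ren k suc id (sub k τ (lookup k σ n))) →
        upλ σ ⨾ upλ τ ≈ upλ (σ ⨾ τ)
⨾-upλ c value zero    = refl
⨾-upλ c value (suc n) = c value n
⨾-upλ c stack n       = c stack n
⨾-upλ c term  n       = c term n

⨾-upS : ∀ {σ τ} →
        (∀ k n → sub k (upS τ) (ren k id suc (lookup k σ n)) ≡ ren k id suc (sub k τ (lookup k σ n))) →
        upS σ ⨾ upS τ ≈ upS (σ ⨾ τ)
⨾-upS c value n       = c value n
⨾-upS c stack zero    = refl
⨾-upS c stack (suc n) = c stack n
⨾-upS c term  n       = c term n

module Fusion (R : Subst → Subst → Set)
              (R-upλ : ∀ {σ τ} → R σ τ → R (upλ σ) (upλ τ))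
              (R-upS : ∀ {σ τ} → R σ τ → R (upS σ) (upS τ))
              (⨾-upλ-R : ∀ {σ τ} → R σ τ → upλ σ ⨾ upλ τ ≈ upλ (σ ⨾ τ))
              (⨾-upS-R : ∀ {σ τ} → R σ τ → upS σ ⨾ upS τ ≈ upS (σ ⨾ τ)) where
  mutual
    subV-⨾ : ∀ {σ τ} → R σ τ → ∀ v → subV τ (subV σ v) ≡ subV (σ ⨾ τ) v
    subV-⨾ r (var x)   = refl
    subV-⨾ r (lam t)   = cong lam (trans (subT-⨾ (R-upλ r) t) (subT-cong (⨾-upλ-R r) t))
    subV-⨾ r (con c v) = cong (con c) (subV-⨾ r v)
    subV-⨾ r (rec fs)  = cong rec (subFs-⨾ r fs)

    subFs-⨾ : ∀ {σ τ} → R σ τ → ∀ fs → subFs τ (subFs σ fs) ≡ subFs (σ ⨾ τ) fs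
    subFs-⨾ r []             = refl
    subFs-⨾ r ((l , v) ∷ fs) = cong₂ (λ w ws → (l , w) ∷ ws) (subV-⨾ r v) (subFs-⨾ r fs)

    subT-⨾ : ∀ {σ τ} → R σ τ → ∀ t → subT τ (subT σ t) ≡ subT (σ ⨾ τ) t
    subT-⨾ r (tvar a)    = refl
    subT-⨾ r (val v)     = cong val (subV-⨾ r v)
    subT-⨾ r (app t u)   = cong₂ app (subT-⨾ r t) (subT-⨾ r u)
    subT-⨾ r (mu t)      = cong mu (trans (subT-⨾ (R-upS r) t) (subT-cong (⨾-upS-R r) t))
    subT-⨾ r (proc p)    = cong proc (subP-⨾ r p)
    subT-⨾ r (proj v l)  = cong (λ w → proj w l) (subV-⨾ r v)
    subT-⨾ r (case v bs) = cong₂ case (subV-⨾ r v) (subBs-⨾ r bs)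
    subT-⨾ r (delta v w) = cong₂ delta (subV-⨾ r v) (subV-⨾ r w)

    subBs-⨾ : ∀ {σ τ} → R σ τ → ∀ bs → subBs τ (subBs σ bs) ≡ subBs (σ ⨾ τ) bs
    subBs-⨾ r []             = refl
    subBs-⨾ r ((c , t) ∷ bs) =
      cong₂ (λ u us → (c , u) ∷ us)
            (trans (subT-⨾ (R-upλ r) t) (subT-cong (⨾-upλ-R r) t))
            (subBs-⨾ r bs)

    subS-⨾ : ∀ {σ τ} → R σ τ → ∀ π → subS τ (subS σ π) ≡ subS (σ ⨾ τ) π
    subS-⨾ r (svar α)    = refl
    subS-⨾ r (push v π)  = cong₂ push (subV-⨾ r v) (subS-⨾ r π)
    subS-⨾ r (frame t π) = cong₂ frame (subT-⨾ r t) (subS-⨾ r π)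

    subP-⨾ : ∀ {σ τ} → R σ τ → ∀ p → subP τ (subP σ p) ≡ subP (σ ⨾ τ) p
    subP-⨾ r (t ∗ π) = cong₂ _∗_ (subT-⨾ r t) (subS-⨾ r π)

  sub-⨾ : ∀ {σ τ} → R σ τ → ∀ k x → sub k τ (sub k σ x) ≡ sub k (σ ⨾ τ) x
  sub-⨾ r value = subV-⨾ r
  sub-⨾ r stack = subS-⨾ r
  sub-⨾ r term  = subT-⨾ r

IsRenaming : Subst → Set
IsRenaming σ = ∃₂ λ f g → σ ≈ ren-subst f g

IsRenaming-upλ : ∀ {σ} → IsRenaming σ → IsRenaming (upλ σ)
IsRenaming-upλ (f , g , e) = ext f , g , ≈-trans (upλ-cong e) (upλ-renaming f g)

IsRenaming-upS : ∀ {σ} → IsRenaming σ → IsRenaming (upS σ)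
IsRenaming-upS (f , g , e) = f , ext g , ≈-trans (upS-cong e) (upS-renaming f g)

wkλ-isRenaming : IsRenaming wkλ
wkλ-isRenaming = suc , id , λ k n → refl

wkμ-isRenaming : IsRenaming wkμ
wkμ-isRenaming = id , suc , λ k n → refl

renaming-⨾-upλ : ∀ {σ τ} → IsRenaming σ → upλ σ ⨾ upλ τ ≈ upλ (σ ⨾ τ)
renaming-⨾-upλ (f , g , e) value zero    = refl
renaming-⨾-upλ (f , g , e) value (suc n) rewrite e value n = refl
renaming-⨾-upλ (f , g , e) stack n       rewrite e stack n = refl
renaming-⨾-upλ (f , g , e) term  n       rewrite e term n  = refl

renaming-⨾-upS : ∀ {σ τ} → IsRenaming σ → upS σ ⨾ upS τ ≈ upS (σ ⨾ τ)
renaming-⨾-upS (f , g , e) value n       rewrite e value n = refl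
renaming-⨾-upS (f , g , e) stack zero    = refl
renaming-⨾-upS (f , g , e) stack (suc n) rewrite e stack n = refl
renaming-⨾-upS (f , g , e) term  n       rewrite e term n  = refl

module RenamingFusion = Fusion (λ σ τ → IsRenaming σ) IsRenaming-upλ IsRenaming-upS
                               renaming-⨾-upλ renaming-⨾-upS

sub-renaming-⨾ : ∀ {σ τ} → IsRenaming σ → ∀ k x → sub k τ (sub k σ x) ≡ sub k (σ ⨾ τ) x
sub-renaming-⨾ = RenamingFusion.sub-⨾

wkλ-⨾-upλ : ∀ τ → wkλ ⨾ upλ τ ≈ τ ⨾ wkλ
wkλ-⨾-upλ τ value n = ren-as-sub value suc id (onλ τ n)
wkλ-⨾-upλ τ stack n = ren-as-sub stack suc id (onS τ n)
wkλ-⨾-upλ τ term  n = ren-as-sub term  suc id (onT τ n)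

wkμ-⨾-upS : ∀ τ → wkμ ⨾ upS τ ≈ τ ⨾ wkμ
wkμ-⨾-upS τ value n = ren-as-sub value id suc (onλ τ n)
wkμ-⨾-upS τ stack n = ren-as-sub stack id suc (onS τ n)
wkμ-⨾-upS τ term  n = ren-as-sub term  id suc (onT τ n)

upλ-weaken-comm : ∀ τ → (∀ k x → sub k wkλ (sub k τ x) ≡ sub k (τ ⨾ wkλ) x) →
                  ∀ k x → sub k (upλ τ) (ren k suc id x) ≡ ren k suc id (sub k τ x)
upλ-weaken-comm τ fuse k x = begin
  sub k (upλ τ) (ren k suc id x)  ≡⟨ cong (sub k (upλ τ)) (ren-as-sub k suc id x) ⟩
  sub k (upλ τ) (sub k wkλ x)     ≡⟨ sub-renaming-⨾ wkλ-isRenaming k x ⟩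
  sub k (wkλ ⨾ upλ τ) x           ≡⟨ sub-cong (wkλ-⨾-upλ τ) k x ⟩
  sub k (τ ⨾ wkλ) x               ≡⟨ sym (fuse k x) ⟩
  sub k wkλ (sub k τ x)           ≡⟨ sym (ren-as-sub k suc id (sub k τ x)) ⟩
  ren k suc id (sub k τ x)        ∎
  where open ≡-Reasoning

upS-weaken-comm : ∀ τ → (∀ k x → sub k wkμ (sub k τ x) ≡ sub k (τ ⨾ wkμ) x) →
                  ∀ k x → sub k (upS τ) (ren k id suc x) ≡ ren k id suc (sub k τ x)
upS-weaken-comm τ fuse k x = begin
  sub k (upS τ) (ren k id suc x)  ≡⟨ cong (sub k (upS τ)) (ren-as-sub k id suc x) ⟩
  sub k (upS τ) (sub k wkμ x)     ≡⟨ sub-renaming-⨾ wkμ-isRenaming k x ⟩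
  sub k (wkμ ⨾ upS τ) x           ≡⟨ sub-cong (wkμ-⨾-upS τ) k x ⟩
  sub k (τ ⨾ wkμ) x               ≡⟨ sym (fuse k x) ⟩
  sub k wkμ (sub k τ x)           ≡⟨ sym (ren-as-sub k id suc (sub k τ x)) ⟩
  ren k id suc (sub k τ x)        ∎
  where open ≡-Reasoning

module FusionRenaming = Fusion (λ σ τ → IsRenaming τ) IsRenaming-upλ IsRenaming-upS
  (λ r → ⨾-upλ (λ k n → upλ-weaken-comm _ (λ k → sub-renaming-⨾ r k) k _))
  (λ r → ⨾-upS (λ k n → upS-weaken-comm _ (λ k → sub-renaming-⨾ r k) k _))

sub-⨾-renaming : ∀ {σ τ} → IsRenaming τ → ∀ k x → sub k τ (sub k σ x) ≡ sub k (σ ⨾ τ) x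
sub-⨾-renaming = FusionRenaming.sub-⨾

module GeneralFusion = Fusion (λ σ τ → ⊤) (λ _ → tt) (λ _ → tt)
  (λ _ → ⨾-upλ (λ k n → upλ-weaken-comm _ (sub-⨾-renaming wkλ-isRenaming) k _))
  (λ _ → ⨾-upS (λ k n → upS-weaken-comm _ (sub-⨾-renaming wkμ-isRenaming) k _))

sub-⨾ : ∀ σ τ k x → sub k τ (sub k σ x) ≡ sub k (σ ⨾ τ) x
sub-⨾ σ τ = GeneralFusion.sub-⨾ tt

sub₀ : Val → Subst
sub₀ v = subst at₀ svar tvar
  where
  at₀ : ℕ → Val
  at₀ zero    = v
  at₀ (suc n) = var n

[0≔]-as-sub : ∀ t v → t [0≔ v ] ≡ subT (sub₀ v) t
[0≔]-as-sub t v = subT-cong (λ { value zero → refl ; value (suc n) → refl ; stack n → refl ; term n → refl }) t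

sub₀-weaken : ∀ v k x → sub k (sub₀ v) (ren k suc id x) ≡ x
sub₀-weaken v k x = begin
  sub k (sub₀ v) (ren k suc id x)  ≡⟨ cong (sub k (sub₀ v)) (ren-as-sub k suc id x) ⟩
  sub k (sub₀ v) (sub k wkλ x)     ≡⟨ sub-⨾ wkλ (sub₀ v) k x ⟩
  sub k (wkλ ⨾ sub₀ v) x           ≡⟨ sub-id (λ k n → refl) k x ⟩
  x                                ∎
  where open ≡-Reasoning

sub₀-⨾ : ∀ σ v → sub₀ v ⨾ σ ≈ upλ σ ⨾ sub₀ (subV σ v)
sub₀-⨾ σ v value zero    = refl
sub₀-⨾ σ v value (suc n) = sym (sub₀-weaken (subV σ v) value (onλ σ n))
sub₀-⨾ σ v stack n       = sym (sub₀-weaken (subV σ v) stack (onS σ n))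
sub₀-⨾ σ v term  n       = sym (sub₀-weaken (subV σ v) term  (onT σ n))

subT-[0≔] : ∀ σ t v → subT σ (t [0≔ v ]) ≡ subT (upλ σ) t [0≔ subV σ v ]
subT-[0≔] σ t v = begin
  subT σ (t [0≔ v ])                      ≡⟨ cong (subT σ) ([0≔]-as-sub t v) ⟩
  subT σ (subT (sub₀ v) t)                ≡⟨ sub-⨾ (sub₀ v) σ term t ⟩
  subT (sub₀ v ⨾ σ) t                     ≡⟨ subT-cong (sub₀-⨾ σ v) t ⟩
  subT (upλ σ ⨾ sub₀ w) t                 ≡⟨ sym (sub-⨾ (upλ σ) (sub₀ w) term t) ⟩
  subT (sub₀ w) (subT (upλ σ) t)          ≡⟨ sym ([0≔]-as-sub (subT (upλ σ) t) w) ⟩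
  subT (upλ σ) t [0≔ w ]                  ∎
  where
  open ≡-Reasoning
  w : Val
  w = subV σ v

conv-⇔-deterministic-step : ∀ {R : Proc → Proc → Set} {p q} → ¬ Final p → R p q →
                            (∀ {r} → R p r → r ≡ q) → Conv R p ⇔ Conv R q
conv-⇔-deterministic-step {R} ¬final step unique = mk⇔ backward forward
  where
  backward : Conv R _ → Conv R _
  backward (r , ε , final-r)       = ⊥-elim (¬final final-r)
  backward (r , s ◅ steps , final-r) = r , transport (λ p → Star R p r) (unique s) steps , final-r
  forward : Conv R _ → Conv R _
  forward (r , steps , final-r) = r , step ◅ steps , final-r

app-step-unique : ∀ {j t u π q} → Step j (app t u ∗ π) q → q ≡ (u ∗ frame t π)
app-step-unique (inj₁ (≻-app _ _ _))        = refl
app-step-unique (inj₂ (_ , _ , _ , () , _))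

frame-step-unique : ∀ {j v t π q} → Step j (val v ∗ frame t π) q → q ≡ (t ∗ push v π)
frame-step-unique (inj₁ (≻-frame _ _ _))      = refl
frame-step-unique (inj₂ (_ , _ , _ , () , _))

beta-step-unique : ∀ {j t v π q} → Step j (val (lam t) ∗ push v π) q → q ≡ (t [0≔ v ] ∗ π)
beta-step-unique (inj₁ (≻-beta _ _ _))       = refl
beta-step-unique (inj₂ (_ , _ , _ , () , _))

conv-β : ∀ j t v π → Conv (Step j) (app (val (lam t)) (val v) ∗ π) ⇔ Conv (Step j) (t [0≔ v ] ∗ π)
conv-β j t v π =
  ⇔-trans (conv-⇔-deterministic-step (λ ()) (inj₁ (≻-app _ _ _)) app-step-unique)
  (⇔-trans (conv-⇔-deterministic-step (λ ()) (inj₁ (≻-frame _ _ _)) frame-step-unique)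
           (conv-⇔-deterministic-step (λ ()) (inj₁ (≻-beta _ _ _)) beta-step-unique))

≡ᵒ-from-EquivAt : ∀ {t u} → (∀ j → EquivAt j t u) → t ≡ᵒ u
≡ᵒ-from-EquivAt h zero    = h zero
≡ᵒ-from-EquivAt h (suc i) = ≡ᵒ-from-EquivAt h i , h (suc i)

theorem9 : (t : Term) (v : Val) → app (val (lam t)) (val v) ≡ᵒ (t [0≔ v ])
theorem9 t v = ≡ᵒ-from-EquivAt λ j π σ →
  transport (λ u → Conv (Step j) (subT σ (app (val (lam t)) (val v)) ∗ π) ⇔ Conv (Step j) (u ∗ π))
            (sym (subT-[0≔] σ t v))
            (conv-β j (subT (upλ σ) t) (subV σ v) π)
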